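{- (Soundness) If $\Gamma\vdash p:A$ is derivable in minimal intuitionistic predicate logic (MQC), then in any world $w$ of any IK-CPS model, if $w\Vdash\Gamma$ (i.e. every formula of $\Gamma$ is forced at $w$), then $w\Vdash A$.
   Context: MQC is the natural deduction system with proof terms for the connectives $\wedge,\vee,\Rightarrow,\forall,\exists$ (no $\bot$), with judgements $\Gamma\vdash p:A$ where $\Gamma$ is a context of hypotheses $a:A$, given by the rules: axiom ($(a:A)\in\Gamma$ gives $\Gamma\vdash a:A$); $\wedge$-introduction $(p,q)$ and eliminations $\pi_1 p,\pi_2 p$; $\vee$-introductions $\iota_1 p,\iota_2 p$ and elimination $\mathrm{case}\ p\ \mathrm{of}\ (a_1.q_1 \| a_2.q_2)$ deriving any $C$ from $\Gamma\vdash p:A_1\vee A_2$, $\Gamma,a_1:A_1\vdash q_1:C$, $\Gamma,a_2:A_2\vdash q_2:C$; $\Rightarrow$-introduction $\lambda a.p$ and elimination $p\,q$; $\forall$-introduction $\lambda x.p$ (with $x$ fresh) and elimination $p\,t$ giving $A(t)$; $\exists$-introduction $(t,p)$ from $A(t)$, and elimination $\mathrm{dest}\ p\ \mathrm{as}\ (x,a)\ \mathrm{in}\ q$ deriving $C$ from $\Gamma\vdash p:\exists x.A(x)$ and $\Gamma,a:A(x)\vdash q:C$ with $x$ fresh. An IK-CPS model consists of: a preorder $(K,\le)$ of worlds; a binary relation $w \Vdash_\bot^{C}$ between worlds and formulas ("exploding"); a strong forcing relation $w \Vdash_s X$ for atomic $X$, monotone in $w$; and domains $D(w)$ increasing in $w$.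 Strong forcing is extended simultaneously with forcing $\Vdash$: $w \Vdash A$ iff for every formula $C$ and every $w'\ge w$, if for all $w''\ge w'$ ($w''\Vdash_s A$ implies $w''\Vdash_\bot^{C}$), then $w'\Vdash_\bot^{C}$; $w\Vdash_s A\wedge B$ iff $w\Vdash A$ and $w\Vdash B$; $w\Vdash_s A\vee B$ iff $w\Vdash A$ or $w\Vdash B$; $w\Vdash_s A\Rightarrow B$ iff for all $w'\ge w$, $w'\Vdash A$ implies $w'\Vdash B$; $w\Vdash_s \forall x.A(x)$ iff for all $w'\ge w$ and $t\in D(w')$, $w'\Vdash A(t)$; $w\Vdash_s \exists x.A(x)$ iff $w\Vdash A(t)$ for some $t\in D(w)$. -}

module Defs where

open import Data.Nat using (ℕ; zero; suc)
open import Data.Fin using (Fin; zero; suc)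
open import Data.Vec using (Vec; []; _∷_)
open import Data.List using (List; map)
open import Data.List.Membership.Propositional using (_∈_)
open import Data.Product using (Σ; ∃; _×_; _,_)
open import Data.Sum using (_⊎_)

record Signature : Set₁ where
  field
    FunSym   : Set
    funArity : FunSym → ℕ
    PredSym  : Set
    predArity : PredSym → ℕ

module Syntax (S : Signature) where
  open Signature S

  data Term (n : ℕ) : Set where
    var : Fin n → Term n
    fun : (f : FunSym) → Vec (Term n) (funArity f) → Term n

  infixr 6 _∧′_
  infixr 5 _∨′_
  infixr 4 _⇒′_
  data Formula (n : ℕ) : Set where
    atom : (P : PredSym) → Vec (Term n) (predArity P) → Formula n
    _∧′_ _∨′_ _⇒′_ : Formula n → Formula n → Formula n
    all ex : Formula (suc n) → Formula n

  mutual
    renT : ∀ {m n} → (Fin m → Fin n) → Term m → Term n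
    renT ρ (var i) = var (ρ i)
    renT ρ (fun f ts) = fun f (renTs ρ ts)

    renTs : ∀ {m n k} → (Fin m → Fin n) → Vec (Term m) k → Vec (Term n) k
    renTs ρ [] = []
    renTs ρ (t ∷ ts) = renT ρ t ∷ renTs ρ ts

  liftR : ∀ {m n} → (Fin m → Fin n) → Fin (suc m) → Fin (suc n)
  liftR ρ zero = zero
  liftR ρ (suc i) = suc (ρ i)

  renF : ∀ {m n} → (Fin m → Fin n) → Formula m → Formula n
  renF ρ (atom P ts) = atom P (renTs ρ ts)
  renF ρ (A ∧′ B) = renF ρ A ∧′ renF ρ B
  renF ρ (A ∨′ B) = renF ρ A ∨′ renF ρ B
  renF ρ (A ⇒′ B) = renF ρ A ⇒′ renF ρ B
  renF ρ (all A) = all (renF (liftR ρ) A)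
  renF ρ (ex A) = ex (renF (liftR ρ) A)

  wkF : ∀ {n} → Formula n → Formula (suc n)
  wkF = renF suc

  mutual
    subT : ∀ {m n} → (Fin m → Term n) → Term m → Term n
    subT σ (var i) = σ i
    subT σ (fun f ts) = fun f (subTs σ ts)

    subTs : ∀ {m n k} → (Fin m → Term n) → Vec (Term m) k → Vec (Term n) k
    subTs σ [] = []
    subTs σ (t ∷ ts) = subT σ t ∷ subTs σ ts

  liftS : ∀ {m n} → (Fin m → Term n) → Fin (suc m) → Term (suc n)
  liftS σ zero = var zero
  liftS σ (suc i) = renT suc (σ i)

  subF : ∀ {m n} → (Fin m → Term n) → Formula m → Formula n
  subF σ (atom P ts) = atom P (subTs σ ts)
  subF σ (A ∧′ B) = subF σ A ∧′ subF σ B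
  subF σ (A ∨′ B) = subF σ A ∨′ subF σ B
  subF σ (A ⇒′ B) = subF σ A ⇒′ subF σ B
  subF σ (all A) = all (subF (liftS σ) A)
  subF σ (ex A) = ex (subF (liftS σ) A)

  inst : ∀ {n} → Term n → Fin (suc n) → Term n
  inst t zero = t
  inst t (suc i) = var i

  _[_] : ∀ {n} → Formula (suc n) → Term n → Formula n
  A [ t ] = subF (inst t) A

  Context : ℕ → Set
  Context n = List (Formula n)

  -- An inhabitant of
  -- Γ ⊢ A is a (well-typed) proof term p with Γ ⊢ p : A; the
  -- constructors are the proof-term formers.  Freshness side
  -- conditions are enforced by de Bruijn indexing of term variables
  -- (the context is weakened under ∀-intro / ∃-elim).
  infix 2 _⊢_
  data _⊢_ {n : ℕ} (Γ : Context n) : Formula n → Set where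
    axiom : ∀ {A} → A ∈ Γ → Γ ⊢ A
    pair  : ∀ {A B} → Γ ⊢ A → Γ ⊢ B → Γ ⊢ A ∧′ B
    π₁    : ∀ {A B} → Γ ⊢ A ∧′ B → Γ ⊢ A
    π₂    : ∀ {A B} → Γ ⊢ A ∧′ B → Γ ⊢ B
    ι₁    : ∀ {A B} → Γ ⊢ A → Γ ⊢ A ∨′ B
    ι₂    : ∀ {A B} → Γ ⊢ B → Γ ⊢ A ∨′ B
    case  : ∀ {A₁ A₂ C} → Γ ⊢ A₁ ∨′ A₂ → (A₁ Data.List.∷ Γ) ⊢ C
          → (A₂ Data.List.∷ Γ) ⊢ C → Γ ⊢ C
    lam   : ∀ {A B} → (A Data.List.∷ Γ) ⊢ B → Γ ⊢ A ⇒′ B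
    app   : ∀ {A B} → Γ ⊢ A ⇒′ B → Γ ⊢ A → Γ ⊢ B
    Lam   : ∀ {A} → map wkF Γ ⊢ A → Γ ⊢ all A
    App   : ∀ {A} → Γ ⊢ all A → (t : Term n) → Γ ⊢ A [ t ]
    witness : ∀ {A} → (t : Term n) → Γ ⊢ A [ t ] → Γ ⊢ ex A
    dest  : ∀ {A C} → Γ ⊢ ex A → (A Data.List.∷ map wkF Γ) ⊢ wkF C → Γ ⊢ C

record IKCPSModel (S : Signature) : Set₁ where
  open Signature S
  open Syntax S
  field
    K      : Set
    _≤_    : K → K → Set
    ≤-refl  : ∀ {w} → w ≤ w
    ≤-trans : ∀ {w w′ w″} → w ≤ w′ → w′ ≤ w″ → w ≤ w″
    -- exploding relation  w ⊩⊥^C, C ranging over all formulas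
    Exploding : K → Σ ℕ Formula → Set
    -- individuals; D(w) is the subset InD w, increasing in w
    Dom    : Set
    InD    : K → Dom → Set
    InD-mono : ∀ {w w′ d} → w ≤ w′ → InD w d → InD w′ d
    funI   : (f : FunSym) → Vec Dom (funArity f) → Dom
    funI-D : ∀ {w} f (ds : Vec Dom (funArity f)) →
             (∀ i → InD w (Data.Vec.lookup ds i)) → InD w (funI f ds)
    StrongAtom : K → (P : PredSym) → Vec Dom (predArity P) → Set
    StrongAtom-mono : ∀ {w w′ P ds} → w ≤ w′ → StrongAtom w P ds → StrongAtom w′ P ds

module Forcing {S : Signature} (M : IKCPSModel S) where
  open Signature S
  open Syntax S
  open IKCPSModel M

  Env : ℕ → Set
  Env n = Fin n → Dom

  extend : ∀ {n} → Dom → Env n → Env (suc n)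
  extend d ρ zero = d
  extend d ρ (suc i) = ρ i

  mutual
    evalT : ∀ {n} → Env n → Term n → Dom
    evalT ρ (var i) = ρ i
    evalT ρ (fun f ts) = funI f (evalTs ρ ts)

    evalTs : ∀ {n k} → Env n → Vec (Term n) k → Vec Dom k
    evalTs ρ [] = []
    evalTs ρ (t ∷ ts) = evalT ρ t ∷ evalTs ρ ts

  Force : (K → Set) → K → Set
  Force Strong w = ∀ (C : Σ ℕ Formula) (w′ : K) → w ≤ w′ →
    (∀ (w″ : K) → w′ ≤ w″ → Strong w″ → Exploding w″ C) → Exploding w′ C

  _⊩s_[_] : ∀ {n} → K → Formula n → Env n → Set
  w ⊩s atom P ts [ ρ ] = StrongAtom w P (evalTs ρ ts)
  w ⊩s A ∧′ B [ ρ ] = Force (λ v → v ⊩s A [ ρ ]) w × Force (λ v → v ⊩s B [ ρ ]) w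
  w ⊩s A ∨′ B [ ρ ] = Force (λ v → v ⊩s A [ ρ ]) w ⊎ Force (λ v → v ⊩s B [ ρ ]) w
  w ⊩s A ⇒′ B [ ρ ] = ∀ w′ → w ≤ w′ →
    Force (λ v → v ⊩s A [ ρ ]) w′ → Force (λ v → v ⊩s B [ ρ ]) w′
  w ⊩s all A [ ρ ] = ∀ w′ → w ≤ w′ → ∀ (d : Dom) → InD w′ d →
    Force (λ v → v ⊩s A [ extend d ρ ]) w′
  w ⊩s ex A [ ρ ] = ∃ λ (d : Dom) → InD w d × Force (λ v → v ⊩s A [ extend d ρ ]) w

  _⊩_[_] : ∀ {n} → K → Formula n → Env n → Set
  w ⊩ A [ ρ ] = Force (λ v → v ⊩s A [ ρ ]) w

  _⊩ctx_[_] : ∀ {n} → K → Context n → Env n → Set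
  w ⊩ctx Γ [ ρ ] = ∀ {B} → B ∈ Γ → w ⊩ B [ ρ ]

-- Forcing is the continuation transform  Force  of strong forcing, and
-- Force is a monad on monotone predicates over worlds: strong forcing is
-- monotone, so it can be returned, and a forced statement can be bound
-- against any continuation valid in all larger worlds.  Soundness is then
-- an induction on derivations in which introduction rules build strong
-- forcing and return it, and elimination rules bind the forcing of the
-- major premise.  The quantifier rules also need that strong forcing
-- commutes with renaming and substitution of terms.
module Submission where

open import Data.Nat using (ℕ; suc)
open import Data.Fin using (Fin; zero; suc)
open import Data.Vec using (Vec; []; _∷_; lookup)
open import Data.List using (map; _∷_)
open import Data.List.Relation.Unary.Any using (here; there)
open import Data.List.Membership.Propositional.Properties using (∈-map⁻)
open import Data.Product using (_,_; proj₁; proj₂; map₂)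
open import Data.Product.Function.NonDependent.Propositional using (_×-⇔_)
open import Data.Sum using (inj₁; inj₂)
open import Data.Sum.Function.Propositional using (_⊎-⇔_)
open import Function using (_∘_)
open import Function.Bundles using (_⇔_; mk⇔; Equivalence)
open import Function.Construct.Identity using (⇔-id)
open import Function.Related.TypeIsomorphisms using (→-cong-⇔)
open import Relation.Binary.PropositionalEquality using (_≡_; refl; cong; cong₂; trans; _≗_)
open import Defs

open Equivalence using (to; from)

Π-⇔ : ∀ {X : Set} {P Q : X → Set} → (∀ x → P x ⇔ Q x) → (∀ x → P x) ⇔ (∀ x → Q x)
Π-⇔ P⇔Q = mk⇔ (λ f x → to (P⇔Q x) (f x)) (λ f x → from (P⇔Q x) (f x))

module Soundness (S : Signature) (M : IKCPSModel S) where
  open Signature S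
  open Syntax S
  open IKCPSModel M
  open Forcing M

  Force-mono : ∀ {St : K → Set} {w w′} → w ≤ w′ → Force St w → Force St w′
  Force-mono w≤w′ f C w″ w′≤w″ = f C w″ (≤-trans w≤w′ w′≤w″)

  Force-map : ∀ {St T : K → Set} {w} → (∀ v → St v → T v) → Force St w → Force T w
  Force-map g f C w′ w≤w′ k = f C w′ w≤w′ (λ w″ w′≤w″ → k w″ w′≤w″ ∘ g w″)

  Force-bind : ∀ {St T : K → Set} {w} → Force St w →
               (∀ w′ → w ≤ w′ → St w′ → Force T w′) → Force T w
  Force-bind f g C w′ w≤w′ k =
    f C w′ w≤w′ (λ w″ w′≤w″ s → g w″ (≤-trans w≤w′ w′≤w″) s C w″ ≤-refl
                                   (λ w‴ w″≤w‴ → k w‴ (≤-trans w′≤w″ w″≤w‴)))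

  Force-cong : ∀ {St T : K → Set} {w} → (∀ v → St v ⇔ T v) → Force St w ⇔ Force T w
  Force-cong St⇔T = mk⇔ (Force-map (to ∘ St⇔T)) (Force-map (from ∘ St⇔T))

  ⊩s-mono : ∀ {n} (A : Formula n) {ρ : Env n} {w w′} → w ≤ w′ → w ⊩s A [ ρ ] → w′ ⊩s A [ ρ ]
  ⊩s-mono (atom P ts) w≤w′ s = StrongAtom-mono w≤w′ s
  ⊩s-mono (A ∧′ B) w≤w′ (a , b) = Force-mono w≤w′ a , Force-mono w≤w′ b
  ⊩s-mono (A ∨′ B) w≤w′ (inj₁ a) = inj₁ (Force-mono w≤w′ a)
  ⊩s-mono (A ∨′ B) w≤w′ (inj₂ b) = inj₂ (Force-mono w≤w′ b)
  ⊩s-mono (A ⇒′ B) w≤w′ f w″ w′≤w″ = f w″ (≤-trans w≤w′ w′≤w″)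
  ⊩s-mono (all A) w≤w′ f w″ w′≤w″ = f w″ (≤-trans w≤w′ w′≤w″)
  ⊩s-mono (ex A) w≤w′ (d , d∈D , a) = d , InD-mono w≤w′ d∈D , Force-mono w≤w′ a

  ⊩s⇒⊩ : ∀ {n} (A : Formula n) {ρ : Env n} {w} → w ⊩s A [ ρ ] → w ⊩ A [ ρ ]
  ⊩s⇒⊩ A s C w′ w≤w′ k = k w′ ≤-refl (⊩s-mono A w≤w′ s)

  mutual
    evalT-renT : ∀ {m n} {r : Fin m → Fin n} {ρ : Env n} {ρ′ : Env m} →
                 ρ ∘ r ≗ ρ′ → ∀ t → evalT ρ (renT r t) ≡ evalT ρ′ t
    evalT-renT h (var i) = h i
    evalT-renT h (fun f ts) = cong (funI f) (evalTs-renTs h ts)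

    evalTs-renTs : ∀ {m n k} {r : Fin m → Fin n} {ρ : Env n} {ρ′ : Env m} →
                   ρ ∘ r ≗ ρ′ → (ts : Vec (Term m) k) → evalTs ρ (renTs r ts) ≡ evalTs ρ′ ts
    evalTs-renTs h [] = refl
    evalTs-renTs h (t ∷ ts) = cong₂ _∷_ (evalT-renT h t) (evalTs-renTs h ts)

  mutual
    evalT-subT : ∀ {m n} {σ : Fin m → Term n} {ρ : Env n} {ρ′ : Env m} →
                 evalT ρ ∘ σ ≗ ρ′ → ∀ t → evalT ρ (subT σ t) ≡ evalT ρ′ t
    evalT-subT h (var i) = h i
    evalT-subT h (fun f ts) = cong (funI f) (evalTs-subTs h ts)

    evalTs-subTs : ∀ {m n k} {σ : Fin m → Term n} {ρ : Env n} {ρ′ : Env m} →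
                   evalT ρ ∘ σ ≗ ρ′ → (ts : Vec (Term m) k) → evalTs ρ (subTs σ ts) ≡ evalTs ρ′ ts
    evalTs-subTs h [] = refl
    evalTs-subTs h (t ∷ ts) = cong₂ _∷_ (evalT-subT h t) (evalTs-subTs h ts)

  StrongAtom-cong : ∀ {w P} {ds ds′ : Vec Dom (predArity P)} →
                    ds ≡ ds′ → StrongAtom w P ds ⇔ StrongAtom w P ds′
  StrongAtom-cong refl = ⇔-id _

  extend-liftR : ∀ {m n} {r : Fin m → Fin n} {ρ : Env n} {ρ′ : Env m} →
                 ρ ∘ r ≗ ρ′ → ∀ d → extend d ρ ∘ liftR r ≗ extend d ρ′
  extend-liftR h d zero = refl
  extend-liftR h d (suc i) = h i

  extend-liftS : ∀ {m n} {σ : Fin m → Term n} {ρ : Env n} {ρ′ : Env m} →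
                 evalT ρ ∘ σ ≗ ρ′ → ∀ d → evalT (extend d ρ) ∘ liftS σ ≗ extend d ρ′
  extend-liftS h d zero = refl
  extend-liftS {σ = σ} h d (suc i) = trans (evalT-renT (λ _ → refl) (σ i)) (h i)

  mutual
    ⊩s-renF : ∀ {m n} (A : Formula m) {r : Fin m → Fin n} {ρ : Env n} {ρ′ : Env m} →
              ρ ∘ r ≗ ρ′ → ∀ w → w ⊩s renF r A [ ρ ] ⇔ w ⊩s A [ ρ′ ]
    ⊩s-renF (atom P ts) h w = StrongAtom-cong (evalTs-renTs h ts)
    ⊩s-renF (A ∧′ B) h w = ⊩-renF A h w ×-⇔ ⊩-renF B h w
    ⊩s-renF (A ∨′ B) h w = ⊩-renF A h w ⊎-⇔ ⊩-renF B h w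
    ⊩s-renF (A ⇒′ B) h w =
      Π-⇔ λ w′ → Π-⇔ λ _ → →-cong-⇔ (⊩-renF A h w′) (⊩-renF B h w′)
    ⊩s-renF (all A) h w =
      Π-⇔ λ w′ → Π-⇔ λ _ → Π-⇔ λ d → Π-⇔ λ _ → ⊩-renF A (extend-liftR h d) w′
    ⊩s-renF (ex A) h w = mk⇔
      (λ (d , a) → d , map₂ (to   (⊩-renF A (extend-liftR h d) w)) a)
      (λ (d , a) → d , map₂ (from (⊩-renF A (extend-liftR h d) w)) a)

    ⊩-renF : ∀ {m n} (A : Formula m) {r : Fin m → Fin n} {ρ : Env n} {ρ′ : Env m} →
             ρ ∘ r ≗ ρ′ → ∀ w → w ⊩ renF r A [ ρ ] ⇔ w ⊩ A [ ρ′ ]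
    ⊩-renF A h w = Force-cong (⊩s-renF A h)

  mutual
    ⊩s-subF : ∀ {m n} (A : Formula m) {σ : Fin m → Term n} {ρ : Env n} {ρ′ : Env m} →
              evalT ρ ∘ σ ≗ ρ′ → ∀ w → w ⊩s subF σ A [ ρ ] ⇔ w ⊩s A [ ρ′ ]
    ⊩s-subF (atom P ts) h w = StrongAtom-cong (evalTs-subTs h ts)
    ⊩s-subF (A ∧′ B) h w = ⊩-subF A h w ×-⇔ ⊩-subF B h w
    ⊩s-subF (A ∨′ B) h w = ⊩-subF A h w ⊎-⇔ ⊩-subF B h w
    ⊩s-subF (A ⇒′ B) h w =
      Π-⇔ λ w′ → Π-⇔ λ _ → →-cong-⇔ (⊩-subF A h w′) (⊩-subF B h w′)
    ⊩s-subF (all A) h w =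
      Π-⇔ λ w′ → Π-⇔ λ _ → Π-⇔ λ d → Π-⇔ λ _ → ⊩-subF A (extend-liftS h d) w′
    ⊩s-subF (ex A) h w = mk⇔
      (λ (d , a) → d , map₂ (to   (⊩-subF A (extend-liftS h d) w)) a)
      (λ (d , a) → d , map₂ (from (⊩-subF A (extend-liftS h d) w)) a)

    ⊩-subF : ∀ {m n} (A : Formula m) {σ : Fin m → Term n} {ρ : Env n} {ρ′ : Env m} →
             evalT ρ ∘ σ ≗ ρ′ → ∀ w → w ⊩ subF σ A [ ρ ] ⇔ w ⊩ A [ ρ′ ]
    ⊩-subF A h w = Force-cong (⊩s-subF A h)

  ⊩-wkF : ∀ {n} (A : Formula n) {ρ : Env n} d w → w ⊩ wkF A [ extend d ρ ] ⇔ w ⊩ A [ ρ ]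
  ⊩-wkF A d = ⊩-renF A (λ _ → refl)

  ⊩-inst : ∀ {n} (A : Formula (suc n)) t {ρ : Env n} w →
           w ⊩ (A [ t ]) [ ρ ] ⇔ w ⊩ A [ extend (evalT ρ t) ρ ]
  ⊩-inst A t = ⊩-subF A λ { zero → refl ; (suc i) → refl }

  InDs : ∀ {k} → K → (Fin k → Dom) → Set
  InDs w ds = ∀ i → InD w (ds i)

  InDs-mono : ∀ {k w w′} {ds : Fin k → Dom} → w ≤ w′ → InDs w ds → InDs w′ ds
  InDs-mono w≤w′ ds∈D = InD-mono w≤w′ ∘ ds∈D

  InDs-extend : ∀ {n w d} {ρ : Env n} → InD w d → InDs w ρ → InDs w (extend d ρ)
  InDs-extend d∈D ρ∈D zero = d∈D
  InDs-extend d∈D ρ∈D (suc i) = ρ∈D i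

  mutual
    evalT-InD : ∀ {n w} {ρ : Env n} → InDs w ρ → ∀ t → InD w (evalT ρ t)
    evalT-InD ρ∈D (var i) = ρ∈D i
    evalT-InD {ρ = ρ} ρ∈D (fun f ts) = funI-D f (evalTs ρ ts) (evalTs-InD ρ∈D ts)

    evalTs-InD : ∀ {n w k} {ρ : Env n} → InDs w ρ → (ts : Vec (Term n) k) →
                 InDs w (lookup (evalTs ρ ts))
    evalTs-InD ρ∈D (t ∷ ts) zero = evalT-InD ρ∈D t
    evalTs-InD ρ∈D (t ∷ ts) (suc i) = evalTs-InD ρ∈D ts i

  ⊩ctx-mono : ∀ {n w w′} {Γ : Context n} {ρ : Env n} → w ≤ w′ → w ⊩ctx Γ [ ρ ] → w′ ⊩ctx Γ [ ρ ]
  ⊩ctx-mono w≤w′ γ = Force-mono w≤w′ ∘ γ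

  ⊩ctx-∷ : ∀ {n w} {Γ : Context n} {ρ : Env n} {A} →
           w ⊩ A [ ρ ] → w ⊩ctx Γ [ ρ ] → w ⊩ctx (A ∷ Γ) [ ρ ]
  ⊩ctx-∷ a γ (here refl) = a
  ⊩ctx-∷ a γ (there B∈Γ) = γ B∈Γ

  ⊩ctx-wkF : ∀ {n w} {Γ : Context n} {ρ : Env n} d → w ⊩ctx Γ [ ρ ] → w ⊩ctx map wkF Γ [ extend d ρ ]
  ⊩ctx-wkF {w = w} d γ B∈Γ with ∈-map⁻ wkF B∈Γ
  ... | B , B∈Γ′ , refl = from (⊩-wkF B d w) (γ B∈Γ′)

  soundness : ∀ {n} {Γ : Context n} {A : Formula n} → Γ ⊢ A →
              ∀ w (ρ : Env n) → InDs w ρ → w ⊩ctx Γ [ ρ ] → w ⊩ A [ ρ ]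
  soundness (axiom A∈Γ) w ρ ρ∈D γ = γ A∈Γ
  soundness (pair {A} {B} p q) w ρ ρ∈D γ =
    ⊩s⇒⊩ (A ∧′ B) (soundness p w ρ ρ∈D γ , soundness q w ρ ρ∈D γ)
  soundness (π₁ p) w ρ ρ∈D γ = Force-bind (soundness p w ρ ρ∈D γ) λ _ _ → proj₁
  soundness (π₂ p) w ρ ρ∈D γ = Force-bind (soundness p w ρ ρ∈D γ) λ _ _ → proj₂
  soundness (ι₁ {A} {B} p) w ρ ρ∈D γ = ⊩s⇒⊩ (A ∨′ B) (inj₁ (soundness p w ρ ρ∈D γ))
  soundness (ι₂ {A} {B} p) w ρ ρ∈D γ = ⊩s⇒⊩ (A ∨′ B) (inj₂ (soundness p w ρ ρ∈D γ))
  soundness (case p q₁ q₂) w ρ ρ∈D γ = Force-bind (soundness p w ρ ρ∈D γ) λ where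
    w′ w≤w′ (inj₁ a) → soundness q₁ w′ ρ (InDs-mono w≤w′ ρ∈D) (⊩ctx-∷ a (⊩ctx-mono w≤w′ γ))
    w′ w≤w′ (inj₂ a) → soundness q₂ w′ ρ (InDs-mono w≤w′ ρ∈D) (⊩ctx-∷ a (⊩ctx-mono w≤w′ γ))
  soundness (lam {A} {B} q) w ρ ρ∈D γ = ⊩s⇒⊩ (A ⇒′ B) λ w′ w≤w′ a →
    soundness q w′ ρ (InDs-mono w≤w′ ρ∈D) (⊩ctx-∷ a (⊩ctx-mono w≤w′ γ))
  soundness (app p q) w ρ ρ∈D γ = Force-bind (soundness p w ρ ρ∈D γ) λ w′ w≤w′ f →
    f w′ ≤-refl (Force-mono w≤w′ (soundness q w ρ ρ∈D γ))
  soundness (Lam {A} q) w ρ ρ∈D γ = ⊩s⇒⊩ (all A) λ w′ w≤w′ d d∈D →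
    soundness q w′ (extend d ρ) (InDs-extend d∈D (InDs-mono w≤w′ ρ∈D))
              (⊩ctx-wkF d (⊩ctx-mono w≤w′ γ))
  soundness (App {A} p t) w ρ ρ∈D γ = Force-bind (soundness p w ρ ρ∈D γ) λ w′ w≤w′ f →
    from (⊩-inst A t w′) (f w′ ≤-refl (evalT ρ t) (evalT-InD (InDs-mono w≤w′ ρ∈D) t))
  soundness (witness {A} t p) w ρ ρ∈D γ = ⊩s⇒⊩ (ex A)
    (evalT ρ t , evalT-InD ρ∈D t , to (⊩-inst A t w) (soundness p w ρ ρ∈D γ))
  soundness (dest {A} {C} p q) w ρ ρ∈D γ = Force-bind (soundness p w ρ ρ∈D γ) λ where
    w′ w≤w′ (d , d∈D , a) → to (⊩-wkF C d w′)
      (soundness q w′ (extend d ρ) (InDs-extend d∈D (InDs-mono w≤w′ ρ∈D))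
                 (⊩ctx-∷ a (⊩ctx-wkF d (⊩ctx-mono w≤w′ γ))))

theorem9 : (S : Signature) (M : IKCPSModel S) →
    let open Syntax S
        open IKCPSModel M
        open Forcing M
    in ∀ {n : ℕ} {Γ : Context n} {A : Formula n} → (p : Γ ⊢ A) →
       ∀ (w : K) (ρ : Env n) → (∀ (i : Fin n) → InD w (ρ i)) →
       w ⊩ctx Γ [ ρ ] → w ⊩ A [ ρ ]
theorem9 S M = Soundness.soundness S M
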